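{- Let $P$ be a finite poset, $I\in\mathcal{IC}(P)$, and $x\in\nabla(I)-I$. Then $x\in\mathrm{Row}(I)$ if and only if $x\in\mathrm{Ceil}(I)$.
   Context: A subset $I\subseteq P$ is interval-closed if whenever $x,y\in I$ and $x\le z\le y$, then $z\in I$; $\mathcal{IC}(P)$ is the set of interval-closed subsets. For $x\in P$, the toggle $t_x$ sends $I$ to $I\triangle\{x\}$ if this set is interval-closed, and to $I$ otherwise. Rowmotion is $\mathrm{Row}=t_{x_1}\circ\cdots\circ t_{x_N}$ for a linear extension $(x_1,\dots,x_N)$ of $P$ (independent of the choice). $\nabla(I)$ is the smallest order filter of $P$ containing $I$, and $\mathrm{Ceil}(I)$ is the set of minimal elements of $\nabla(I)-I$. -}

module Defs where

open import Level using (0ℓ)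
open import Data.Nat using (ℕ)
open import Data.Fin using (Fin) renaming (_≤_ to _≤ᶠ_)
open import Data.Fin.Properties using (all?)
open import Data.Bool using (Bool; true; false; not; if_then_else_; _∧_)
open import Data.List using (List; foldr; map; allFin)
open import Data.Product using (Σ; _×_; _,_)
open import Relation.Nullary using (Dec; yes; no; ¬_; does)
open import Relation.Nullary.Decidable using (_→-dec_)
open import Relation.Binary.PropositionalEquality using (_≡_)
open import Relation.Binary.Structures using (IsDecPartialOrder)
open import Function.Definitions using (Injective)

-- A finite poset: carrier Fin n with a decidable partial order
-- (decidability is automatic classically for finite posets; we need it to compute toggles).
record FinPoset : Set₁ where
  field
    n   : ℕ
    _≤_ : Fin n → Fin n → Set
    isDecPartialOrder : IsDecPartialOrder _≡_ _≤_
  open IsDecPartialOrder isDecPartialOrder public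

module _ (P : FinPoset) where
  open FinPoset P

  Subset : Set
  Subset = Fin n → Bool

  _∈_ : Fin n → Subset → Set
  x ∈ S = S x ≡ true

  _∉_ : Fin n → Subset → Set
  x ∉ S = ¬ (x ∈ S)

  IntervalClosed : Subset → Set
  IntervalClosed I = ∀ x y z → x ∈ I → y ∈ I → x ≤ z → z ≤ y → z ∈ I

  private
    ∈? : ∀ x S → Dec (x ∈ S)
    ∈? x S = Data.Bool._≟_ (S x) true

  IntervalClosed? : ∀ I → Dec (IntervalClosed I)
  IntervalClosed? I =
    all? λ x → all? λ y → all? λ z →
      ∈? x I →-dec (∈? y I →-dec ((x ≤? z) →-dec ((z ≤? y) →-dec ∈? z I)))

  flip : Fin n → Subset → Subset
  flip x I y with x ≟ y
  ... | yes _ = not (I y)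
  ... | no _  = I y

  toggle : Fin n → Subset → Subset
  toggle x I = if does (IntervalClosed? (flip x I)) then flip x I else I

  -- a linear extension, given as an enumeration σ 0, σ 1, …, σ (n-1)
  -- of the elements of P (σ injective, hence bijective) compatible with the order
  record LinearExtension : Set where
    field
      σ         : Fin n → Fin n
      injective : Injective _≡_ _≡_ σ
      monotone  : ∀ i j → σ i ≤ σ j → i ≤ᶠ j

  -- Row = t_{x_1} ∘ ⋯ ∘ t_{x_N}, with x_k = σ (k-1)
  Row : LinearExtension → Subset → Subset
  Row L I = foldr toggle I (map (LinearExtension.σ L) (allFin n))

  _∈∇_ : Fin n → Subset → Set
  x ∈∇ I = Σ (Fin n) λ y → y ∈ I × y ≤ x

  _∈Ceil_ : Fin n → Subset → Set
  x ∈Ceil I = (x ∈∇ I × x ∉ I) ×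
              (∀ y → y ∈∇ I → y ∉ I → y ≤ x → y ≡ x)

-- Rowmotion toggles along the linear extension from the top down, so when t_x is applied only
-- elements y ≰ x have been toggled, and no later toggle touches x. The earlier toggles leave I
-- unchanged on ↓x and never add an element of ↑x (with an element of I below x it would force x
-- in). So t_x adds x exactly when flipping x keeps that state interval-closed, and this happens
-- exactly when no element of ∇(I) − I lies strictly below x.
module Submission where

open import Defs
open import Data.Bool as Bool using (true; not; if_then_else_)
open import Data.Bool.Properties using (¬-not)
open import Data.Empty using (⊥-elim)
open import Data.Fin using (Fin; zero; suc; punchOut) renaming (_<_ to _<ᶠ_)
import Data.Fin.Properties as Finₚ
open import Data.List using ([]; _∷_; _++_; foldr; map; allFin; tabulate)
open import Data.List.Properties using (foldr-++; map-tabulate)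
open import Data.List.Relation.Unary.All using (All; []; _∷_)
open import Data.List.Relation.Unary.All.Properties using (tabulate⁺)
open import Data.Nat using (ℕ; z≤n; s≤s)
open import Data.Nat.Properties using (1+n≰n; <⇒≱)
open import Data.Product using (_×_; _,_; ∃; ∃₂)
open import Function.Base using (_∘_; id)
open import Function.Bundles using (_⇔_; mk⇔)
open import Function.Construct.Composition using (_⇔-∘_)
open import Function.Definitions using (Injective)
open import Relation.Nullary using (¬_; Dec; yes; no; does)
open import Relation.Nullary.Decidable using (decidable-stable)
open import Relation.Binary.PropositionalEquality
  using (_≡_; _≢_; refl; sym; trans; cong; subst; ≢-sym; module ≡-Reasoning)

injective⇒surjective : ∀ {m} {f : Fin m → Fin m} → Injective _≡_ _≡_ f →
                       ∀ y → ∃ λ k → f k ≡ y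
injective⇒surjective {ℕ.suc m} {f} f-injective y with Finₚ.any? (λ k → f k Finₚ.≟ y)
... | yes hit = hit
... | no miss = ⊥-elim (1+n≰n (Finₚ.injective⇒≤ avoid-y-injective))
  where
  y≢f : ∀ k → y ≢ f k
  y≢f k y≡fk = miss (k , sym y≡fk)

  avoid-y : Fin (ℕ.suc m) → Fin m
  avoid-y k = punchOut (y≢f k)

  avoid-y-injective : Injective _≡_ _≡_ avoid-y
  avoid-y-injective eq = f-injective (Finₚ.punchOut-injective (y≢f _) (y≢f _) eq)

tabulate-split : ∀ {a p q} {A : Set a} {Q : A → Set p} {R : A → Set q} {m}
                 (f : Fin m → A) (k : Fin m) →
                 (∀ j → j <ᶠ k → Q (f j)) → (∀ j → k <ᶠ j → R (f j)) →
                 ∃₂ λ pre suf → tabulate f ≡ pre ++ f k ∷ suf × All Q pre × All R suf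
tabulate-split f zero _ after =
  [] , tabulate (f ∘ suc) , refl , [] , tabulate⁺ (λ j → after (suc j) (s≤s z≤n))
tabulate-split f (suc k) before after
  with pre , suf , eq , Q-pre , R-suf ←
         tabulate-split (f ∘ suc) k (λ j → before (suc j) ∘ s≤s) (λ j → after (suc j) ∘ s≤s)
  = f zero ∷ pre , suf , cong (f zero ∷_) eq , before zero (s≤s z≤n) ∷ Q-pre , R-suf

module _ (P : FinPoset) where
  open FinPoset P using (n; _≤_; _≟_; antisym) renaming (refl to ≤-refl; trans to ≤-trans)

  flip-≢ : ∀ {y z} (S : Subset P) → z ≢ y → flip P y S z ≡ S z
  flip-≢ {y} {z} S z≢y with y ≟ z
  ... | yes y≡z = ⊥-elim (z≢y (sym y≡z))
  ... | no _    = refl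

  ∈-flip-self : ∀ {y} (S : Subset P) → S y ≢ true → flip P y S y ≡ true
  ∈-flip-self {y} S y∉S with y ≟ y
  ... | yes _   = cong not (¬-not y∉S)
  ... | no y≢y  = ⊥-elim (y≢y refl)

  data ToggleView (y : Fin n) (S : Subset P) : Subset P → Set where
    flipped : IntervalClosed P (flip P y S) → ToggleView y S (flip P y S)
    kept    : ¬ IntervalClosed P (flip P y S) → ToggleView y S S

  toggle-view : ∀ y S → ToggleView y S (toggle P y S)
  toggle-view y S = view (IntervalClosed? P (flip P y S))
    where
    view : (d : Dec (IntervalClosed P (flip P y S))) →
           ToggleView y S (if does d then flip P y S else S)
    view (yes ic) = flipped ic
    view (no ¬ic) = kept ¬ic

  toggle-≢ : ∀ {y z} (S : Subset P) → y ≢ z → toggle P y S z ≡ S z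
  toggle-≢ {y} S y≢z with toggle P y S | toggle-view y S
  ... | _ | flipped _ = flip-≢ S (≢-sym y≢z)
  ... | _ | kept _    = refl

  foldr-toggle-≢ : ∀ {z} S ys → All (_≢ z) ys → foldr (toggle P) S ys z ≡ S z
  foldr-toggle-≢ S []       []             = refl
  foldr-toggle-≢ S (y ∷ ys) (y≢z ∷ ys≢z) =
    trans (toggle-≢ (foldr (toggle P) S ys) y≢z) (foldr-toggle-≢ S ys ys≢z)

  ∈-toggle-self⇔ : ∀ {y} (S : Subset P) → S y ≢ true →
                   (toggle P y S y ≡ true ⇔ IntervalClosed P (flip P y S))
  ∈-toggle-self⇔ {y} S y∉S with toggle P y S | toggle-view y S
  ... | _ | flipped ic = mk⇔ (λ _ → ic) (λ _ → ∈-flip-self S y∉S)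
  ... | _ | kept ¬ic   = mk⇔ (⊥-elim ∘ y∉S) (⊥-elim ∘ ¬ic)

  -- Invariant of the states J through which Row passes from I before it applies t_x.
  record Compatible (I : Subset P) (x : Fin n) (J : Subset P) : Set where
    field
      intervalClosed : IntervalClosed P J
      agreeBelow     : ∀ z → z ≤ x → J z ≡ I z
      emptyAbove     : ∀ z → x ≤ z → J z ≢ true

  module _ {I : Subset P} {x : Fin n} (x∈∇I : _∈∇_ P x I) (x∉I : _∉_ P x I) where

    compatible-self : IntervalClosed P I → Compatible I x I
    compatible-self icI = record
      { intervalClosed = icI
      ; agreeBelow     = λ _ _ → refl
      ; emptyAbove     = λ z x≤z z∈I →
          let (a , a∈I , a≤x) = x∈∇I in x∉I (icI a z x a∈I z∈I a≤x x≤z)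
      }

    -- Toggling y ≰ x cannot put anything above x into J: with a ∈ I below x
    -- it would force x into the (interval-closed) result, while x ∉ J.
    compatible-toggle : ∀ {y J} → ¬ y ≤ x → Compatible I x J → Compatible I x (toggle P y J)
    compatible-toggle {y} {J} y≰x compat with toggle P y J | toggle-view y J
    ... | _ | kept _     = compat
    ... | _ | flipped ic = record
      { intervalClosed = ic
      ; agreeBelow     = agreeBelow′
      ; emptyAbove     = λ z x≤z z∈F →
          let (a , a∈I , a≤x) = x∈∇I
              a∈F = trans (agreeBelow′ a a≤x) a∈I
          in x∉I (trans (sym (agreeBelow′ x ≤-refl)) (ic a z x a∈F z∈F a≤x x≤z))
      }
      where
      open Compatible compat
      agreeBelow′ : ∀ z → z ≤ x → flip P y J z ≡ I z
      agreeBelow′ z z≤x = trans (flip-≢ J (λ { refl → y≰x z≤x })) (agreeBelow z z≤x)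

    compatible-foldr : IntervalClosed P I → ∀ ys → All (λ y → ¬ y ≤ x) ys →
                       Compatible I x (foldr (toggle P) I ys)
    compatible-foldr icI []       []             = compatible-self icI
    compatible-foldr icI (y ∷ ys) (y≰x ∷ ys≰x) =
      compatible-toggle y≰x (compatible-foldr icI ys ys≰x)

  module _ {I J : Subset P} {x : Fin n} (compat : Compatible I x J) where
    open Compatible compat

    flip-agreeBelow : ∀ {z} → z ≢ x → z ≤ x → flip P x J z ≡ I z
    flip-agreeBelow z≢x z≤x = trans (flip-≢ J z≢x) (agreeBelow _ z≤x)

    intervalClosed-flip⇒∈Ceil : _∈∇_ P x I → _∉_ P x I →
                               IntervalClosed P (flip P x J) → _∈Ceil_ P x I
    intervalClosed-flip⇒∈Ceil x∈∇I x∉I ic = (x∈∇I , x∉I) , minimal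
      where
      x∈F : flip P x J x ≡ true
      x∈F = ∈-flip-self J (emptyAbove x ≤-refl)

      minimal : ∀ y → _∈∇_ P y I → _∉_ P y I → y ≤ x → y ≡ x
      minimal y (c , c∈I , c≤y) y∉I y≤x with y ≟ x
      ... | yes y≡x = y≡x
      ... | no y≢x  = ⊥-elim (y∉I (trans (sym (flip-agreeBelow y≢x y≤x))
                                         (ic c x y c∈F x∈F c≤y y≤x)))
        where
        c∈F : flip P x J c ≡ true
        c∈F = trans (flip-agreeBelow (λ { refl → x∉I c∈I }) (≤-trans c≤y y≤x)) c∈I

    ∈Ceil⇒intervalClosed-flip : _∈Ceil_ P x I → IntervalClosed P (flip P x J)
    ∈Ceil⇒intervalClosed-flip (_ , minimal) p q z p∈F q∈F p≤z z≤q
      with z ≟ x | p ≟ x | q ≟ x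
    ... | yes refl | _        | _        = ∈-flip-self J (emptyAbove z ≤-refl)
    ... | no z≢x   | yes refl | yes refl = ⊥-elim (z≢x (antisym z≤q p≤z))
    ... | no _     | yes refl | no q≢x   =
      ⊥-elim (emptyAbove q (≤-trans p≤z z≤q) (trans (sym (flip-≢ J q≢x)) q∈F))
    ... | no z≢x   | no p≢x   | yes refl = trans (flip-agreeBelow z≢x z≤q) z∈I
      where
      p∈I = trans (sym (flip-agreeBelow p≢x (≤-trans p≤z z≤q))) p∈F
      z∈I = decidable-stable (I z Bool.≟ true)
              (λ z∉I → z≢x (minimal z (p , p∈I , p≤z) z∉I z≤q))
    ... | no z≢x   | no p≢x   | no q≢x   =
      trans (flip-≢ J z≢x)
            (intervalClosed p q z (trans (sym (flip-≢ J p≢x)) p∈F)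
                                  (trans (sym (flip-≢ J q≢x)) q∈F) p≤z z≤q)

    ∈-toggle-self⇔∈Ceil : _∈∇_ P x I → _∉_ P x I →
                          (toggle P x J x ≡ true ⇔ _∈Ceil_ P x I)
    ∈-toggle-self⇔∈Ceil x∈∇I x∉I =
      mk⇔ (intervalClosed-flip⇒∈Ceil x∈∇I x∉I) ∈Ceil⇒intervalClosed-flip
        ⇔-∘ ∈-toggle-self⇔ J (emptyAbove x ≤-refl)

  module _ (L : LinearExtension P) where
    open LinearExtension L

    σ-<⇒≢ : ∀ {i j} → i <ᶠ j → σ i ≢ σ j
    σ-<⇒≢ i<j = Finₚ.<⇒≢ i<j ∘ injective

    σ-<⇒≱ : ∀ {i j} → i <ᶠ j → ¬ σ j ≤ σ i
    σ-<⇒≱ {i} {j} i<j = <⇒≱ i<j ∘ monotone j i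

    Row-at-≡-toggle-self : (I : Subset P) (x : Fin n) →
             ∃ λ suf → All (λ y → ¬ y ≤ x) suf ×
                       Row P L I x ≡ toggle P x (foldr (toggle P) I suf) x
    Row-at-≡-toggle-self I x with k , refl ← injective⇒surjective injective x
               with pre , suf , eq , pre≢x , suf≰x ← tabulate-split σ k (λ _ → σ-<⇒≢) (λ _ → σ-<⇒≱)
      = suf , suf≰x , (begin
        foldr (toggle P) I (map σ (allFin n)) x  ≡⟨ cong (λ ys → foldr (toggle P) I ys x)
                                                         (trans (map-tabulate id σ) eq) ⟩
        foldr (toggle P) I (pre ++ σ k ∷ suf) x  ≡⟨ cong (λ S → S x) (foldr-++ (toggle P) I pre (σ k ∷ suf)) ⟩
        foldr (toggle P) (foldr (toggle P) I (σ k ∷ suf)) pre x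
                                                 ≡⟨ foldr-toggle-≢ _ pre pre≢x ⟩
        toggle P (σ k) (foldr (toggle P) I suf) (σ k) ∎)
      where open ≡-Reasoning

lemma2p18 : (P : FinPoset) (L : LinearExtension P) (I : Subset P) →
    IntervalClosed P I → ∀ x → _∈∇_ P x I → _∉_ P x I →
    (_∈_ P x (Row P L I) ⇔ _∈Ceil_ P x I)
lemma2p18 P L I icI x x∈∇I x∉I with suf , suf≰x , row≡ ← Row-at-≡-toggle-self P L I x =
  subst (λ b → b ≡ true ⇔ _∈Ceil_ P x I) (sym row≡)
    (∈-toggle-self⇔∈Ceil P (compatible-foldr P x∈∇I x∉I icI suf suf≰x) x∈∇I x∉I)
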